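{- Let $(X,F)$ and $(Y,G)$ be dynamical systems and suppose $(Y,G)$ is a factor of $(X,F)$. If $(X,F)$ is stable, then $(Y,G)$ is stable. (That is, the class of stable systems is an ideal for factor simulation.)
   Context: A dynamical system is a pair $(X,F)$ with $X$ a compact space and $F:X\to X$ continuous. $(Y,G)$ is a factor of $(X,F)$ if there is a continuous surjective $\Phi:X\to Y$ with $\Phi\circ F=G\circ\Phi$. The limit set is $\Omega_F=\bigcap_{t\in\mathbb N}F^t(X)$, and $(X,F)$ is stable if $\Omega_F=F^t(X)$ for some $t\in\mathbb N$. A class $\mathcal C$ of systems is an ideal for factor simulation if whenever $(X,F)$ is a factor of $(Y,G)$ and $(Y,G)\in\mathcal C$, then $(X,F)\in\mathcal C$. -}

module Defs where

open import Level using (0ℓ)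
open import Data.Nat using (ℕ; zero; suc)
open import Data.Unit using (⊤)
open import Data.Product using (∃; _×_; _,_)
open import Data.List using (List)
open import Data.List.Relation.Unary.Any using (Any)
open import Relation.Unary using (Pred; _≐_)
open import Relation.Binary.PropositionalEquality using (_≡_)

record Topology (X : Set) : Set₁ where
  field
    Open     : Pred X 0ℓ → Set
    open-univ : Open (λ _ → ⊤)
    open-∩   : (U V : Pred X 0ℓ) → Open U → Open V → Open (λ x → U x × V x)
    open-⋃   : {I : Set} (U : I → Pred X 0ℓ) → (∀ i → Open (U i)) →
               Open (λ x → ∃ λ i → U i x)
open Topology public

Compact : {X : Set} → Topology X → Set₁
Compact {X} τ =
  {I : Set} (U : I → Pred X 0ℓ) → (∀ i → Open τ (U i)) → (∀ x → ∃ λ i → U i x) →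
  ∃ λ (is : List I) → ∀ x → Any (λ i → U i x) is

Continuous : {X Y : Set} → Topology X → Topology Y → (X → Y) → Set₁
Continuous τX τY f = (U : Pred _ 0ℓ) → Open τY U → Open τX (λ x → U (f x))

record DynSys : Set₁ where
  field
    Carrier    : Set
    topology   : Topology Carrier
    compact    : Compact topology
    map        : Carrier → Carrier
    continuous : Continuous topology topology map
open DynSys public

iter : {X : Set} → (X → X) → ℕ → X → X
iter f zero    x = x
iter f (suc t) x = f (iter f t x)

ImageIter : (S : DynSys) → ℕ → Pred (Carrier S) 0ℓ
ImageIter S t y = ∃ λ x → iter (map S) t x ≡ y

LimitSet : (S : DynSys) → Pred (Carrier S) 0ℓ
LimitSet S y = (t : ℕ) → ImageIter S t y

Stable : DynSys → Set
Stable S = ∃ λ (t : ℕ) → LimitSet S ≐ ImageIter S t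

IsFactorMap : (S T : DynSys) → (Carrier S → Carrier T) → Set₁
IsFactorMap S T Φ =
  Continuous (topology S) (topology T) Φ ×
  (∀ y → ∃ λ x → Φ x ≡ y) ×
  (∀ x → Φ (map S x) ≡ map T (Φ x))

IsFactor : (T S : DynSys) → Set₁
IsFactor T S = ∃ λ (Φ : Carrier S → Carrier T) → IsFactorMap S T Φ

-- A factor map Φ carries F^t(X) onto G^t(Y) and Ω_F into Ω_G. Hence, if
-- Ω_F = F^t(X), then G^t(Y) = Φ(F^t(X)) = Φ(Ω_F) ⊆ Ω_G ⊆ G^t(Y).
module Submission where

open import Defs
open import Data.Nat using (ℕ; zero; suc)
open import Data.Product using (∃; _×_; _,_)
open import Relation.Binary.PropositionalEquality
  using (_≡_; refl; sym; cong; subst; module ≡-Reasoning)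

iter-semiconj : {A B : Set} {f : A → A} {g : B → B} (Φ : A → B) →
  (∀ x → Φ (f x) ≡ g (Φ x)) → ∀ t x → Φ (iter f t x) ≡ iter g t (Φ x)
iter-semiconj Φ semiconj zero    x = refl
iter-semiconj {f = f} {g} Φ semiconj (suc t) x = begin
  Φ (f (iter f t x))    ≡⟨ semiconj (iter f t x) ⟩
  g (Φ (iter f t x))    ≡⟨ cong g (iter-semiconj Φ semiconj t x) ⟩
  g (iter g t (Φ x))    ∎
  where open ≡-Reasoning

LimitSet⊆ImageIter : (S : DynSys) (t : ℕ) {x : Carrier S} →
  LimitSet S x → ImageIter S t x
LimitSet⊆ImageIter S t ω = ω t

module Semiconjugacy (X Y : DynSys) (Φ : Carrier X → Carrier Y)
                    (semiconj : ∀ x → Φ (map X x) ≡ map Y (Φ x)) where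

  ImageIter-image : ∀ t {x} → ImageIter X t x → ImageIter Y t (Φ x)
  ImageIter-image t (x₀ , refl) = Φ x₀ , sym (iter-semiconj Φ semiconj t x₀)

  LimitSet-image : ∀ {x} → LimitSet X x → LimitSet Y (Φ x)
  LimitSet-image ω t = ImageIter-image t (ω t)

  ImageIter-preimage : (∀ y → ∃ λ x → Φ x ≡ y) →
    ∀ t {y} → ImageIter Y t y → ∃ λ x → ImageIter X t x × Φ x ≡ y
  ImageIter-preimage surj t (y₀ , refl) with surj y₀
  ... | x₀ , refl = iter (map X) t x₀ , (x₀ , refl) , iter-semiconj Φ semiconj t x₀

corollary2p2 : (X Y : DynSys) → IsFactor Y X → Stable X → Stable Y
corollary2p2 X Y (Φ , _ , surj , semiconj) (t , _ , ImageIter⊆LimitSet) =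
  t , LimitSet⊆ImageIter Y t , ImageIter⊆LimitSetʸ
  where
  open Semiconjugacy X Y Φ semiconj

  ImageIter⊆LimitSetʸ : ∀ {y} → ImageIter Y t y → LimitSet Y y
  ImageIter⊆LimitSetʸ y∈ with ImageIter-preimage surj t y∈
  ... | x , x∈ , Φx≡y =
    subst (LimitSet Y) Φx≡y (LimitSet-image (ImageIter⊆LimitSet x∈))
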